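{- If $(S,K,I)$ is a split graph and $G$ is a graph (vertex-disjoint from $S$), then $\deg(S\circ G)=\deg(S)+\deg(G)$.
   Context: A split graph $(S,K,I)$ is a graph $S$ with a partition of its vertex set into a clique $K$ and an independent set $I$. The composition $S\circ G$ is the graph obtained from the disjoint union of $S$ and $G$ by adding all edges between $K$ and $V(G)$. A 2-switch acting on a graph $H$ is given by distinct vertices $a,b,c,d$ with $ab,cd\in E(H)$, $ac,bd\notin E(H)$, and transforms $H$ into $(H-\{ab,cd\})+\{ac,bd\}$; the 2-switch-degree $\deg(H)$ is the number of distinct graphs obtainable from $H$ by a single 2-switch. -}

module Defs where

open import Data.Bool using (Bool; true; false; _∧_; _∨_; not; if_then_else_)
import Data.Bool.Properties as BoolP
open import Data.Nat using (ℕ; _+_)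
open import Data.Fin using (Fin; splitAt; _≟_)
open import Data.Sum using (_⊎_; inj₁; inj₂)
open import Data.Product using (_×_; _,_)
open import Data.Vec using (Vec; lookup; tabulate)
open import Data.Vec.Properties using (≡-dec)
open import Data.List using (List; length; map; filter; concatMap; allFin; deduplicate)
open import Relation.Nullary using (¬_)
open import Relation.Nullary.Decidable using (isYes; T?)
open import Relation.Binary.PropositionalEquality using (_≡_)

Graph : ℕ → Set
Graph n = Vec (Vec Bool n) n

adj : ∀ {n} → Graph n → Fin n → Fin n → Bool
adj G u v = lookup (lookup G u) v

record IsGraph {n : ℕ} (G : Graph n) : Set where
  field
    symmetric : ∀ u v → adj G u v ≡ adj G v u
    loopless  : ∀ u → adj G u u ≡ false

-- Split graph (S, K, I): K is given by its indicator function; I is the complement.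
record IsSplit {m : ℕ} (S : Graph m) (K : Fin m → Bool) : Set where
  field
    K-clique      : ∀ u v → ¬ (u ≡ v) → K u ≡ true → K v ≡ true → adj S u v ≡ true
    I-independent : ∀ u v → K u ≡ false → K v ≡ false → adj S u v ≡ false

-- Composition S ∘ G on vertex set Fin (m + n): first m vertices are S, last n are G;
-- all edges between K and V(G) are added.
composeAdj : ∀ {m n} → Graph m → (Fin m → Bool) → Graph n →
             Fin m ⊎ Fin n → Fin m ⊎ Fin n → Bool
composeAdj S K G (inj₁ u) (inj₁ v) = adj S u v
composeAdj S K G (inj₂ u) (inj₂ v) = adj G u v
composeAdj S K G (inj₁ u) (inj₂ v) = K u
composeAdj S K G (inj₂ u) (inj₁ v) = K v

compose : ∀ {m n} → Graph m → (Fin m → Bool) → Graph n → Graph (m + n)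
compose {m} S K G = tabulate λ i → tabulate λ j → composeAdj S K G (splitAt m i) (splitAt m j)

_==_ : ∀ {n} → Fin n → Fin n → Bool
u == v = isYes (u ≟ v)

samePair : ∀ {n} → Fin n → Fin n → Fin n → Fin n → Bool
samePair u v x y = (u == x ∧ v == y) ∨ (u == y ∧ v == x)

switch : ∀ {n} → Graph n → Fin n → Fin n → Fin n → Fin n → Graph n
switch G a b c d = tabulate λ u → tabulate λ v →
  if samePair u v a b ∨ samePair u v c d then false
  else if samePair u v a c ∨ samePair u v b d then true
  else adj G u v

valid : ∀ {n} → Graph n → Fin n → Fin n → Fin n → Fin n → Bool
valid G a b c d =
  not (a == b) ∧ not (a == c) ∧ not (a == d) ∧ not (b == c) ∧ not (b == d) ∧ not (c == d)
  ∧ adj G a b ∧ adj G c d ∧ not (adj G a c) ∧ not (adj G b d)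

Quad : ℕ → Set
Quad n = Fin n × Fin n × Fin n × Fin n

allQuads : ∀ n → List (Quad n)
allQuads n = concatMap (λ a → concatMap (λ b → concatMap (λ c → map (λ d → (a , b , c , d))
               (allFin n)) (allFin n)) (allFin n)) (allFin n)

validQuads : ∀ {n} → Graph n → List (Quad n)
validQuads G = filter (λ { (a , b , c , d) → T? (valid G a b c d) }) (allQuads _)

switchResults : ∀ {n} → Graph n → List (Graph n)
switchResults G = deduplicate (≡-dec (≡-dec BoolP._≟_))
  (map (λ { (a , b , c , d) → switch G a b c d }) (validQuads G))

deg : ∀ {n} → Graph n → ℕ
deg G = length (switchResults G)

-- Every vertex of S ∘ G lies in K, in I or in V(G). Two adjacent vertices either include a
-- vertex of K or both lie in V(G); two distinct non-adjacent ones either include a vertex of I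
-- or both lie in V(G). Along the alternating cycle a–b, b⋯d, d–c, c⋯a of a 2-switch these
-- constraints leave only three configurations, each with all four vertices on the same side.
-- So the 2-switches of S ∘ G are exactly the graphs S′ ∘ G and S ∘ G′ with S′ a 2-switch of S
-- and G′ one of G, and these are pairwise distinct.
module Submission where

open import Defs
open import Data.Bool using (Bool; true; false; _∧_; _∨_; not; if_then_else_; T)
open import Data.Bool.Properties using (∧-conicalˡ; ∧-conicalʳ; ∧-zeroʳ)
open import Data.Nat using (ℕ; _+_)
open import Data.Fin using (Fin; splitAt; join; _↑ˡ_; _↑ʳ_; _≟_)
open import Data.Fin.Properties using (splitAt-↑ˡ; splitAt-↑ʳ; splitAt-join; join-splitAt; ↑ˡ-injective; ↑ʳ-injective)
open import Data.Sum using (_⊎_; inj₁; inj₂)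
open import Data.Product using (_×_; _,_; Σ; proj₁; proj₂)
open import Data.Vec using (lookup; tabulate)
open import Data.Vec.Properties using (lookup∘tabulate; tabulate∘lookup; tabulate-cong; ≡-dec)
open import Data.List using (List; length; map; _++_; allFin)
open import Data.List.Properties using (length-++; length-map)
open import Data.List.Membership.Propositional using (_∈_; lose)
open import Data.List.Membership.Propositional.Properties
  using (∈-map⁺; ∈-map⁻; ∈-++⁺ˡ; ∈-++⁺ʳ; ∈-++⁻; ∈-concatMap⁺; ∈-allFin; ∈-filter⁺; ∈-filter⁻; ∈-deduplicate⁺; ∈-deduplicate⁻)
open import Data.List.Membership.Propositional.Properties.WithK using (unique∧set⇒bag)
open import Data.List.Relation.Unary.Unique.Propositional using (Unique)
import Data.List.Relation.Unary.Unique.Propositional.Properties as Unique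
open import Data.List.Relation.Unary.Unique.DecPropositional.Properties using (deduplicate-!)
open import Data.List.Relation.Binary.BagAndSetEquality using (∼bag⇒↭)
open import Data.List.Relation.Binary.Permutation.Propositional.Properties using (↭-length)
open import Function.Base using (_∘_)
open import Function.Bundles using (_⇔_; mk⇔; Equivalence)
open import Function.Definitions using (Injective)
open import Relation.Nullary using (¬_; yes; no; contradiction)
open import Relation.Binary.PropositionalEquality
  using (_≡_; _≢_; refl; sym; trans; cong; cong₂; subst; subst₂; module ≡-Reasoning)
import Data.Bool.Properties as Bool

==-refl : ∀ {k} (u : Fin k) → (u == u) ≡ true
==-refl u with u ≟ u
... | yes _   = refl
... | no u≢u = contradiction refl u≢u

≢⇒==-false : ∀ {k} {u v : Fin k} → u ≢ v → (u == v) ≡ false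
≢⇒==-false {u = u} {v} u≢v with u ≟ v
... | yes u≡v = contradiction u≡v u≢v
... | no _    = refl

==-false⇒≢ : ∀ {k} {u v : Fin k} → (u == v) ≡ false → u ≢ v
==-false⇒≢ {u = u} u==v refl with trans (sym (==-refl u)) u==v
... | ()

==-injective : ∀ {k l} (f : Fin k → Fin l) → Injective _≡_ _≡_ f → ∀ u v → (f u == f v) ≡ (u == v)
==-injective f f-inj u v with u ≟ v
... | yes refl = ==-refl (f u)
... | no u≢v  = ≢⇒==-false λ fu≡fv → u≢v (f-inj fu≡fv)

adj-tabulate : ∀ {k} (f : Fin k → Fin k → Bool) u v → adj (tabulate λ u → tabulate (f u)) u v ≡ f u v
adj-tabulate f u v rewrite lookup∘tabulate (λ u → tabulate (f u)) u = lookup∘tabulate (f u) v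

tabulate-adj : ∀ {k} (A : Graph k) → tabulate (λ u → tabulate (adj A u)) ≡ A
tabulate-adj A = trans (tabulate-cong λ u → tabulate∘lookup (lookup A u)) (tabulate∘lookup A)

adj-ext : ∀ {k} {A B : Graph k} → (∀ u v → adj A u v ≡ adj B u v) → A ≡ B
adj-ext {A = A} {B} A≗B = begin
  A                                    ≡⟨ sym (tabulate-adj A) ⟩
  tabulate (λ u → tabulate (adj A u))  ≡⟨ tabulate-cong (λ u → tabulate-cong (A≗B u)) ⟩
  tabulate (λ u → tabulate (adj B u))  ≡⟨ tabulate-adj B ⟩
  B                                    ∎
  where open ≡-Reasoning

data IsSwitchOf {k} (H : Graph k) : Graph k → Set where
  switched : ∀ a b c d → valid H a b c d ≡ true → IsSwitchOf H (switch H a b c d)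

adj-switch : ∀ {k} (H : Graph k) a b c d u v → adj (switch H a b c d) u v ≡
  (if samePair u v a b ∨ samePair u v c d then false
   else if samePair u v a c ∨ samePair u v b d then true
   else adj H u v)
adj-switch H a b c d = adj-tabulate _

switch-row-outside : ∀ {k} (H : Graph k) {a b c d u} → u ≢ a → u ≢ b → u ≢ c → u ≢ d →
  ∀ v → adj (switch H a b c d) u v ≡ adj H u v
switch-row-outside H {a} {b} {c} {d} {u} u≢a u≢b u≢c u≢d v
  rewrite adj-switch H a b c d u v
        | ≢⇒==-false u≢a | ≢⇒==-false u≢b | ≢⇒==-false u≢c | ≢⇒==-false u≢d = refl

switch-column-outside : ∀ {k} (H : Graph k) {a b c d v} → v ≢ a → v ≢ b → v ≢ c → v ≢ d →
  ∀ u → adj (switch H a b c d) u v ≡ adj H u v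
switch-column-outside H {a} {b} {c} {d} {v} v≢a v≢b v≢c v≢d u
  rewrite adj-switch H a b c d u v
        | ≢⇒==-false v≢a | ≢⇒==-false v≢b | ≢⇒==-false v≢c | ≢⇒==-false v≢d
        | ∧-zeroʳ (u == a) | ∧-zeroʳ (u == b) | ∧-zeroʳ (u == c) | ∧-zeroʳ (u == d) = refl

∧-true : ∀ x {y} → x ∧ y ≡ true → x ≡ true × y ≡ true
∧-true x {y} e = ∧-conicalˡ x y e , ∧-conicalʳ x y e

not-true : ∀ {x} → not x ≡ true → x ≡ false
not-true {false} _ = refl

record SwitchShape {k} (H : Graph k) (a b c d : Fin k) : Set where
  field
    a≢c : a ≢ c
    b≢d : b ≢ d
    ab∈E : adj H a b ≡ true
    cd∈E : adj H c d ≡ true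
    ac∉E : adj H a c ≡ false
    bd∉E : adj H b d ≡ false

valid⇒shape : ∀ {k} (H : Graph k) a b c d → valid H a b c d ≡ true → SwitchShape H a b c d
valid⇒shape H a b c d v =
  let (_   , v₁) = ∧-true (not (a == b)) v
      (a≠c , v₂) = ∧-true (not (a == c)) v₁
      (_   , v₃) = ∧-true (not (a == d)) v₂
      (_   , v₄) = ∧-true (not (b == c)) v₃
      (b≠d , v₅) = ∧-true (not (b == d)) v₄
      (_   , v₆) = ∧-true (not (c == d)) v₅
      (ab  , v₇) = ∧-true (adj H a b) v₆
      (cd  , v₈) = ∧-true (adj H c d) v₇
      (ac  , bd) = ∧-true (not (adj H a c)) v₈
  in record { a≢c = ==-false⇒≢ (not-true a≠c) ; b≢d = ==-false⇒≢ (not-true b≠d)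
            ; ab∈E = ab ; cd∈E = cd ; ac∉E = not-true ac ; bd∉E = not-true bd }

switch-changes : ∀ {k} {H H′ : Graph k} → IsSwitchOf H H′ → H′ ≢ H
switch-changes {H = H} (switched a b c d v) H′≡H = contradiction ab-after λ ()
  where
  ab-after : true ≡ false
  ab-after = begin
    true                          ≡⟨ sym (SwitchShape.ab∈E (valid⇒shape H a b c d v)) ⟩
    adj H a b                     ≡⟨ cong (λ X → adj X a b) (sym H′≡H) ⟩
    adj (switch H a b c d) a b    ≡⟨ removed ⟩
    false                         ∎
    where
    open ≡-Reasoning
    removed : adj (switch H a b c d) a b ≡ false
    removed rewrite adj-switch H a b c d a b | ==-refl a | ==-refl b = refl

∈-allQuads : ∀ {k} (a b c d : Fin k) → (a , b , c , d) ∈ allQuads k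
∈-allQuads a b c d =
  ∈-concatMap⁺ _ (lose (∈-allFin a) (∈-concatMap⁺ _ (lose (∈-allFin b)
    (∈-concatMap⁺ _ (lose (∈-allFin c) (∈-map⁺ _ (∈-allFin d)))))))

validQuad : ∀ {k} → Graph k → Quad k → Bool
validQuad H (a , b , c , d) = valid H a b c d

∈-switchResults⁺ : ∀ {k} {H H′ : Graph k} → IsSwitchOf H H′ → H′ ∈ switchResults H
∈-switchResults⁺ {H = H} (switched a b c d v) =
  ∈-deduplicate⁺ _ (∈-map⁺ _ (∈-filter⁺ {P = T ∘ validQuad H} _ (∈-allQuads a b c d) (Equivalence.from Bool.T-≡ v)))

∈-switchResults⁻ : ∀ {k} {H H′ : Graph k} → H′ ∈ switchResults H → IsSwitchOf H H′
∈-switchResults⁻ {k} {H} H′∈ with ∈-map⁻ _ (∈-deduplicate⁻ (≡-dec (≡-dec Bool._≟_)) _ H′∈)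
... | (a , b , c , d) , q∈ , refl =
  switched a b c d (Equivalence.to Bool.T-≡ (∈-filter⁻ {P = T ∘ validQuad H} _ {xs = allQuads k} q∈ .proj₂))

switchResults-unique : ∀ {k} (H : Graph k) → Unique (switchResults H)
switchResults-unique H = deduplicate-! (≡-dec (≡-dec Bool._≟_)) _

unique-length : ∀ {a} {A : Set a} {xs ys : List A} → Unique xs → Unique ys →
  (∀ {z} → z ∈ xs ⇔ z ∈ ys) → length xs ≡ length ys
unique-length xs! ys! xs∼ys = ↭-length (∼bag⇒↭ (unique∧set⇒bag xs! ys! xs∼ys))

module Induced {k l} (φ : Fin k → Fin l) (φ-injective : Injective _≡_ _≡_ φ)
  (H : Graph l) (H′ : Graph k) (adj-φ : ∀ u v → adj H (φ u) (φ v) ≡ adj H′ u v) where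

  private
    φ== : ∀ u v → (φ u == φ v) ≡ (u == v)
    φ== = ==-injective φ φ-injective

  valid-induced : ∀ a b c d → valid H (φ a) (φ b) (φ c) (φ d) ≡ valid H′ a b c d
  valid-induced a b c d
    rewrite φ== a b | φ== a c | φ== a d | φ== b c | φ== b d | φ== c d
          | adj-φ a b | adj-φ c d | adj-φ a c | adj-φ b d = refl

  switch-induced : ∀ a b c d u v →
    adj (switch H (φ a) (φ b) (φ c) (φ d)) (φ u) (φ v) ≡ adj (switch H′ a b c d) u v
  switch-induced a b c d u v
    rewrite adj-switch H (φ a) (φ b) (φ c) (φ d) (φ u) (φ v) | adj-switch H′ a b c d u v
          | φ== u a | φ== u b | φ== u c | φ== u d | φ== v a | φ== v b | φ== v c | φ== v d
          | adj-φ u v = refl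

↑ˡ≢↑ʳ : ∀ {m n} (i : Fin m) (j : Fin n) → i ↑ˡ n ≢ m ↑ʳ j
↑ˡ≢↑ʳ {m} {n} i j eq with trans (sym (splitAt-↑ˡ m i n)) (trans (cong (splitAt m) eq) (splitAt-↑ʳ m n j))
... | ()

↑ʳ≢↑ˡ : ∀ {m n} (j : Fin n) (i : Fin m) → m ↑ʳ j ≢ i ↑ˡ n
↑ʳ≢↑ˡ j i eq = ↑ˡ≢↑ʳ i j (sym eq)

adj-compose : ∀ {m n} (S : Graph m) (K : Fin m → Bool) (G : Graph n) x y →
  adj (compose S K G) (join m n x) (join m n y) ≡ composeAdj S K G x y
adj-compose {m} {n} S K G x y
  rewrite adj-tabulate (λ i j → composeAdj S K G (splitAt m i) (splitAt m j)) (join m n x) (join m n y)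
        | splitAt-join m n x | splitAt-join m n y = refl

≡-compose : ∀ {m n} {A : Graph (m + n)} (S : Graph m) (K : Fin m → Bool) (G : Graph n) →
  (∀ x y → adj A (join m n x) (join m n y) ≡ composeAdj S K G x y) → A ≡ compose S K G
≡-compose {m} {n} {A} S K G A≗SG = adj-ext λ i j →
  subst₂ (λ i j → adj A i j ≡ adj (compose S K G) i j) (join-splitAt m n i) (join-splitAt m n j)
    (trans (A≗SG (splitAt m i) (splitAt m j)) (sym (adj-compose S K G (splitAt m i) (splitAt m j))))

compose-injective : ∀ {m n} {S S′ : Graph m} {K : Fin m → Bool} {G G′ : Graph n} →
  compose S K G ≡ compose S′ K G′ → S ≡ S′ × G ≡ G′
compose-injective {m} {n} {S} {S′} {K} {G} {G′} eq =
  adj-ext (λ u v → entry (inj₁ u) (inj₁ v)) , adj-ext (λ u v → entry (inj₂ u) (inj₂ v))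
  where
  entry : ∀ x y → composeAdj S K G x y ≡ composeAdj S′ K G′ x y
  entry x y = trans (sym (adj-compose S K G x y))
                (trans (cong (λ X → adj X (join m n x) (join m n y)) eq) (adj-compose S′ K G′ x y))

data Part : Set where
  inK inI inG : Part

data Joinable : Part → Part → Set where
  K∼ : ∀ {p} → Joinable inK p
  ∼K : ∀ {p} → Joinable p inK
  G∼G : Joinable inG inG

data Separable : Part → Part → Set where
  I≁ : ∀ {p} → Separable inI p
  ≁I : ∀ {p} → Separable p inI
  G≁G : Separable inG inG

isInG : Part → Bool
isInG inG = true
isInG _   = false

switch-parts-agree : ∀ {p q r s} → Joinable p q → Joinable r s → Separable p r → Separable q s →
  Σ Bool λ t → isInG p ≡ t × isInG q ≡ t × isInG r ≡ t × isInG s ≡ t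
switch-parts-agree K∼  ∼K  ≁I  I≁  = false , refl , refl , refl , refl
switch-parts-agree ∼K  K∼  I≁  ≁I  = false , refl , refl , refl , refl
switch-parts-agree G∼G G∼G G≁G G≁G = true , refl , refl , refl , refl

part : ∀ {m n} → (Fin m → Bool) → Fin m ⊎ Fin n → Part
part K (inj₁ u) = if K u then inK else inI
part K (inj₂ _) = inG

module _ {m n} {S : Graph m} {K : Fin m → Bool} (G : Graph n) (split : IsSplit S K) where
  open IsSplit split

  adjacent⇒joinable : ∀ x y → composeAdj S K G x y ≡ true → Joinable (part K x) (part K y)
  adjacent⇒joinable (inj₁ u) (inj₁ v) uv∈E with K u in Ku | K v in Kv
  ... | true  | _     = K∼
  ... | false | true  = ∼K
  ... | false | false with trans (sym uv∈E) (I-independent u v Ku Kv)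
  ...   | ()
  adjacent⇒joinable (inj₁ u) (inj₂ v) Ku rewrite Ku = K∼
  adjacent⇒joinable (inj₂ u) (inj₁ v) Kv rewrite Kv = ∼K
  adjacent⇒joinable (inj₂ u) (inj₂ v) _  = G∼G

  nonadjacent⇒separable : ∀ x y → x ≢ y → composeAdj S K G x y ≡ false → Separable (part K x) (part K y)
  nonadjacent⇒separable (inj₁ u) (inj₁ v) x≢y uv∉E with K u in Ku | K v in Kv
  ... | false | _     = I≁
  ... | true  | false = ≁I
  ... | true  | true with trans (sym uv∉E) (K-clique u v (λ u≡v → x≢y (cong inj₁ u≡v)) Ku Kv)
  ...   | ()
  nonadjacent⇒separable (inj₁ u) (inj₂ v) _ Ku rewrite Ku = I≁
  nonadjacent⇒separable (inj₂ u) (inj₁ v) _ Kv rewrite Kv = ≁I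
  nonadjacent⇒separable (inj₂ u) (inj₂ v) _ _  = G≁G

data OnSide {m n} : Bool → Fin m ⊎ Fin n → Set where
  left  : ∀ u → OnSide false (inj₁ u)
  right : ∀ u → OnSide true (inj₂ u)

onSide : ∀ {m n} (K : Fin m → Bool) (x : Fin m ⊎ Fin n) → OnSide (isInG (part K x)) x
onSide K (inj₁ u) with K u
... | true  = left u
... | false = left u
onSide K (inj₂ u) = right u

data OneSide {m n} : (x y z w : Fin m ⊎ Fin n) → Set where
  allLeft  : ∀ a b c d → OneSide (inj₁ a) (inj₁ b) (inj₁ c) (inj₁ d)
  allRight : ∀ a b c d → OneSide (inj₂ a) (inj₂ b) (inj₂ c) (inj₂ d)

oneSide : ∀ {m n t} {x y z w : Fin m ⊎ Fin n} → OnSide t x → OnSide t y → OnSide t z → OnSide t w → OneSide x y z w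
oneSide (left a)  (left b)  (left c)  (left d)  = allLeft a b c d
oneSide (right a) (right b) (right c) (right d) = allRight a b c d

valid-compose-one-side : ∀ {m n} {S : Graph m} {K : Fin m → Bool} (G : Graph n) → IsSplit S K →
  ∀ x y z w → valid (compose S K G) (join m n x) (join m n y) (join m n z) (join m n w) ≡ true →
  OneSide x y z w
valid-compose-one-side {m} {n} {S} {K} G split x y z w v
  with switch-parts-agree (adjacent⇒joinable G split x y (edge x y ab∈E))
                          (adjacent⇒joinable G split z w (edge z w cd∈E))
                          (nonadjacent⇒separable G split x z (distinct a≢c) (edge x z ac∉E))
                          (nonadjacent⇒separable G split y w (distinct b≢d) (edge y w bd∉E))
  where
  open SwitchShape (valid⇒shape (compose S K G) (join m n x) (join m n y) (join m n z) (join m n w) v)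

  edge : ∀ {e} p q → adj (compose S K G) (join m n p) (join m n q) ≡ e → composeAdj S K G p q ≡ e
  edge p q = trans (sym (adj-compose S K G p q))

  distinct : ∀ {p q} → join m n p ≢ join m n q → p ≢ q
  distinct Jp≢Jq p≡q = Jp≢Jq (cong (join m n) p≡q)
... | t , x-side , y-side , z-side , w-side = oneSide (on x x-side) (on y y-side) (on z z-side) (on w w-side)
  where
  on : ∀ p → isInG (part K p) ≡ t → OnSide t p
  on p refl = onSide K p

module Composition {m n} (S : Graph m) (K : Fin m → Bool) (G : Graph n) where

  SG : Graph (m + n)
  SG = compose S K G

  module Left  = Induced (_↑ˡ n) (↑ˡ-injective n _ _) SG S (λ u v → adj-compose S K G (inj₁ u) (inj₁ v))
  module Right = Induced (m ↑ʳ_) (↑ʳ-injective m _ _) SG G (λ u v → adj-compose S K G (inj₂ u) (inj₂ v))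

  switch-compose-left : ∀ a b c d →
    switch SG (a ↑ˡ n) (b ↑ˡ n) (c ↑ˡ n) (d ↑ˡ n) ≡ compose (switch S a b c d) K G
  switch-compose-left a b c d = ≡-compose (switch S a b c d) K G adj-switched
    where
    G-row : ∀ v y → adj (switch SG (a ↑ˡ n) (b ↑ˡ n) (c ↑ˡ n) (d ↑ˡ n)) (m ↑ʳ v) y ≡ adj SG (m ↑ʳ v) y
    G-row v = switch-row-outside SG (↑ʳ≢↑ˡ v a) (↑ʳ≢↑ˡ v b) (↑ʳ≢↑ˡ v c) (↑ʳ≢↑ˡ v d)

    adj-switched : ∀ x y → adj (switch SG (a ↑ˡ n) (b ↑ˡ n) (c ↑ˡ n) (d ↑ˡ n)) (join m n x) (join m n y)
                           ≡ composeAdj (switch S a b c d) K G x y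
    adj-switched (inj₁ u) (inj₁ v) = Left.switch-induced a b c d u v
    adj-switched (inj₁ u) (inj₂ v) =
      trans (switch-column-outside SG (↑ʳ≢↑ˡ v a) (↑ʳ≢↑ˡ v b) (↑ʳ≢↑ˡ v c) (↑ʳ≢↑ˡ v d) (u ↑ˡ n))
            (adj-compose S K G (inj₁ u) (inj₂ v))
    adj-switched (inj₂ u) (inj₁ v) = trans (G-row u (v ↑ˡ n)) (adj-compose S K G (inj₂ u) (inj₁ v))
    adj-switched (inj₂ u) (inj₂ v) = trans (G-row u (m ↑ʳ v)) (adj-compose S K G (inj₂ u) (inj₂ v))

  switch-compose-right : ∀ a b c d →
    switch SG (m ↑ʳ a) (m ↑ʳ b) (m ↑ʳ c) (m ↑ʳ d) ≡ compose S K (switch G a b c d)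
  switch-compose-right a b c d = ≡-compose S K (switch G a b c d) adj-switched
    where
    S-row : ∀ u y → adj (switch SG (m ↑ʳ a) (m ↑ʳ b) (m ↑ʳ c) (m ↑ʳ d)) (u ↑ˡ n) y ≡ adj SG (u ↑ˡ n) y
    S-row u = switch-row-outside SG (↑ˡ≢↑ʳ u a) (↑ˡ≢↑ʳ u b) (↑ˡ≢↑ʳ u c) (↑ˡ≢↑ʳ u d)

    adj-switched : ∀ x y → adj (switch SG (m ↑ʳ a) (m ↑ʳ b) (m ↑ʳ c) (m ↑ʳ d)) (join m n x) (join m n y)
                           ≡ composeAdj S K (switch G a b c d) x y
    adj-switched (inj₂ u) (inj₂ v) = Right.switch-induced a b c d u v
    adj-switched (inj₂ u) (inj₁ v) =
      trans (switch-column-outside SG (↑ˡ≢↑ʳ v a) (↑ˡ≢↑ʳ v b) (↑ˡ≢↑ʳ v c) (↑ˡ≢↑ʳ v d) (m ↑ʳ u))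
            (adj-compose S K G (inj₂ u) (inj₁ v))
    adj-switched (inj₁ u) (inj₁ v) = trans (S-row u (v ↑ˡ n)) (adj-compose S K G (inj₁ u) (inj₁ v))
    adj-switched (inj₁ u) (inj₂ v) = trans (S-row u (m ↑ʳ v)) (adj-compose S K G (inj₁ u) (inj₂ v))

  data IsSwitchOfFactor : Graph (m + n) → Set where
    viaS : ∀ {S′} → IsSwitchOf S S′ → IsSwitchOfFactor (compose S′ K G)
    viaG : ∀ {G′} → IsSwitchOf G G′ → IsSwitchOfFactor (compose S K G′)

  switch-factor⇒switch-compose : ∀ {X} → IsSwitchOfFactor X → IsSwitchOf SG X
  switch-factor⇒switch-compose (viaS (switched a b c d v)) =
    subst (IsSwitchOf SG) (switch-compose-left a b c d) (switched _ _ _ _ (trans (Left.valid-induced a b c d) v))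
  switch-factor⇒switch-compose (viaG (switched a b c d v)) =
    subst (IsSwitchOf SG) (switch-compose-right a b c d) (switched _ _ _ _ (trans (Right.valid-induced a b c d) v))

  switch-compose⇒switch-factor : IsSplit S K → ∀ {X} → IsSwitchOf SG X → IsSwitchOfFactor X
  switch-compose⇒switch-factor split (switched A B C D v)
    rewrite sym (join-splitAt m n A) | sym (join-splitAt m n B) | sym (join-splitAt m n C) | sym (join-splitAt m n D)
    = by-sides (splitAt m A) (splitAt m B) (splitAt m C) (splitAt m D) v
    where
    by-sides : ∀ x y z w → valid SG (join m n x) (join m n y) (join m n z) (join m n w) ≡ true →
      IsSwitchOfFactor (switch SG (join m n x) (join m n y) (join m n z) (join m n w))
    by-sides x y z w v with valid-compose-one-side G split x y z w v
    ... | allLeft a b c d rewrite switch-compose-left a b c d =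
      viaS (switched a b c d (trans (sym (Left.valid-induced a b c d)) v))
    ... | allRight a b c d rewrite switch-compose-right a b c d =
      viaG (switched a b c d (trans (sym (Right.valid-induced a b c d)) v))

  withS : Graph m → Graph (m + n)
  withS S′ = compose S′ K G

  withG : Graph n → Graph (m + n)
  withG G′ = compose S K G′

  switchResultsOfFactors : List (Graph (m + n))
  switchResultsOfFactors = map withS (switchResults S) ++ map withG (switchResults G)

  length-switchResultsOfFactors : length switchResultsOfFactors ≡ deg S + deg G
  length-switchResultsOfFactors = begin
    length switchResultsOfFactors
      ≡⟨ length-++ (map withS (switchResults S)) ⟩
    length (map withS (switchResults S)) + length (map withG (switchResults G))
      ≡⟨ cong₂ _+_ (length-map withS (switchResults S)) (length-map withG (switchResults G)) ⟩
    deg S + deg G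
      ∎
    where open ≡-Reasoning

  switchResultsOfFactors-unique : Unique switchResultsOfFactors
  switchResultsOfFactors-unique =
    Unique.++⁺ (Unique.map⁺ (λ eq → compose-injective eq .proj₁) (switchResults-unique S))
               (Unique.map⁺ (λ eq → compose-injective eq .proj₂) (switchResults-unique G))
               disjoint
    where
    disjoint : ∀ {X} → ¬ (X ∈ map withS (switchResults S) × X ∈ map withG (switchResults G))
    disjoint (p , q) with ∈-map⁻ _ p | ∈-map⁻ _ q
    ... | _ , S′∈ , refl | _ , _ , S′G≡SG′ =
      switch-changes (∈-switchResults⁻ {H = S} S′∈) (compose-injective S′G≡SG′ .proj₁)

  ∈-switchResults-compose : IsSplit S K → ∀ {X} → X ∈ switchResults (compose S K G) ⇔ X ∈ switchResultsOfFactors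
  ∈-switchResults-compose split = mk⇔ (to ∘ switch-compose⇒switch-factor split ∘ ∈-switchResults⁻ {H = SG})
                                      (∈-switchResults⁺ {H = SG} ∘ switch-factor⇒switch-compose ∘ from)
    where
    to : ∀ {X} → IsSwitchOfFactor X → X ∈ switchResultsOfFactors
    to (viaS s) = ∈-++⁺ˡ (∈-map⁺ _ (∈-switchResults⁺ s))
    to (viaG s) = ∈-++⁺ʳ _ (∈-map⁺ _ (∈-switchResults⁺ s))

    from : ∀ {X} → X ∈ switchResultsOfFactors → IsSwitchOfFactor X
    from X∈ with ∈-++⁻ (map withS (switchResults S)) X∈
    ... | inj₁ p with _ , S′∈ , refl ← ∈-map⁻ _ p = viaS (∈-switchResults⁻ {H = S} S′∈)
    ... | inj₂ q with _ , G′∈ , refl ← ∈-map⁻ _ q = viaG (∈-switchResults⁻ {H = G} G′∈)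

mainTheorem7 : (m n : ℕ) (S : Graph m) (K : Fin m → Bool) (G : Graph n) →
    IsGraph S → IsSplit S K → IsGraph G →
    deg (compose S K G) ≡ deg S + deg G
mainTheorem7 m n S K G _ split _ = begin
  deg (compose S K G)            ≡⟨ unique-length (switchResults-unique SG) switchResultsOfFactors-unique
                                                  (∈-switchResults-compose split) ⟩
  length switchResultsOfFactors  ≡⟨ length-switchResultsOfFactors ⟩
  deg S + deg G                  ∎
  where
  open Composition S K G
  open ≡-Reasoning
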